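{- Let ${\cal D}$ be a balanced quadriculated disk with $|{\cal D}|$ unit squares, and let $A$ be the matrix indexed by pairs of plugs with $A_{(p,\tilde p)}$ equal to the number of domino tilings of ${\cal D}\setminus(p\cup\tilde p)$ if $p,\tilde p$ have disjoint interiors and $A_{(p,\tilde p)}=0$ otherwise. If $N\ge4|{\cal D}|$ then all entries of $A^N$ are strictly positive.
   Context: A quadriculated disk ${\cal D}\subset\mathbb{R}^2$ is a finite union of unit squares $[a,a+1]\times[b,b+1]$, $(a,b)\in\mathbb{Z}^2$, contractible with contractible interior; squares have color $(-1)^{a+b}$; ${\cal D}$ is balanced if it has equally many squares of each color. A plug is a union $p\subseteq{\cal D}$ of unit squares of ${\cal D}$ with equally many squares of each color (possibly empty or all of ${\cal D}$). A planar domino tiling of a union of unit squares is a covering by $2\times1$ or $1\times2$ rectangles with disjoint interiors; the empty region has exactly one (empty) tiling. -}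

module Defs where

open import Data.Bool using (Bool; true; false; if_then_else_; _∧_; _∨_; not)
open import Data.Nat as ℕ using (ℕ; zero; suc; _+_; _*_; _≡ᵇ_; _<_)
open import Data.Nat.DivMod using (_%_)
open import Data.Nat.ListAction using (sum)
open import Data.Integer as ℤ using (ℤ; ∣_∣)
open import Data.Product using (_×_; _,_; proj₁; proj₂)
open import Data.List as L using (List; []; _∷_; length; filter; filterᵇ; map; _++_; concatMap)
open import Data.List.Membership.Propositional using (_∈_; _∉_)
open import Data.List.Relation.Unary.Unique.Propositional using (Unique)
open import Data.Fin using (Fin; toℕ)
open import Data.Fin using () renaming (_<?_ to _<ᶠ?_)
open import Data.Vec as V using (Vec; tabulate)
open import Data.Vec.Properties using (≡-dec)
open import Data.Bool.Properties using () renaming (_≟_ to _≟ᴮ_)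
open import Relation.Binary.PropositionalEquality using (_≡_; _≢_)
open import Relation.Nullary using (does)

-- A unit square [a,a+1]×[b,b+1] is identified with its corner (a , b).
Cell : Set
Cell = ℤ × ℤ

Adjacent : Cell → Cell → Set
Adjacent (a , b) (c , d) = ∣ a ℤ.- c ∣ + ∣ b ℤ.- d ∣ ≡ 1

adjacent? : Cell → Cell → Bool
adjacent? (a , b) (c , d) = (∣ a ℤ.- c ∣ + ∣ b ℤ.- d ∣) ≡ᵇ 1

data Reach (P : Cell → Set) : Cell → Cell → Set where
  here : ∀ {c} → P c → Reach P c c
  step : ∀ {c d e} → P c → Adjacent c d → Reach P d e → Reach P c e

Connected : (Cell → Set) → Set
Connected P = ∀ c d → P c → P d → Reach P c d

-- A quadriculated disk: a finite nonempty set of unit squares whose union is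
-- contractible with contractible interior.  Combinatorially:
-- the squares are edge-connected and the complementary squares of ℤ² are
-- edge-connected.
record QuadDisk : Set where
  field
    cells          : List Cell
    unique         : Unique cells
    nonempty       : cells ≢ []
    connected      : Connected (λ c → c ∈ cells)
    complConnected : Connected (λ c → c ∉ cells)

open QuadDisk public

size : QuadDisk → ℕ
size D = length (cells D)

cell : (D : QuadDisk) → Fin (size D) → Cell
cell D = L.lookup (cells D)

-- colour (-1)^(a+b): true means +1 (a+b even)
colour : Cell → Bool
colour (a , b) = (∣ a ℤ.+ b ∣ % 2) ≡ᵇ 0

countIf : ∀ {n} → (Fin n → Bool) → ℕ
countIf f = V.countᵇ f (tabulate (λ i → i))

allFin : ∀ {n} → (Fin n → Bool) → Bool
allFin f = V.foldr _ _∧_ true (tabulate f)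

-- a union of unit squares of D, as the characteristic vector over the squares of D
Region : QuadDisk → Set
Region D = Vec Bool (size D)

numPos : (D : QuadDisk) → Region D → ℕ
numPos D r = countIf (λ i → V.lookup r i ∧ colour (cell D i))

numNeg : (D : QuadDisk) → Region D → ℕ
numNeg D r = countIf (λ i → V.lookup r i ∧ not (colour (cell D i)))

full : (D : QuadDisk) → Region D
full D = tabulate (λ _ → true)

Balanced : QuadDisk → Set
Balanced D = numPos D (full D) ≡ numNeg D (full D)

IsPlug : (D : QuadDisk) → Region D → Set
IsPlug D p = numPos D p ≡ numNeg D p

allSubsets : (n : ℕ) → List (Vec Bool n)
allSubsets zero = V.[] ∷ []
allSubsets (suc n) = map (true V.∷_) (allSubsets n) ++ map (false V.∷_) (allSubsets n)

-- all plugs of D (each subset listed exactly once)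
plugs : (D : QuadDisk) → List (Region D)
plugs D = filter (λ p → numPos D p ℕ.≟ numNeg D p) (allSubsets (size D))

allPairs : (n : ℕ) → List (Fin n × Fin n)
allPairs n = concatMap (λ i → map (λ j → (i , j)) (L.allFin n)) (L.allFin n)

dominoes : (D : QuadDisk) → List (Fin (size D) × Fin (size D))
dominoes D = filterᵇ (λ { (i , j) → does (i <ᶠ? j) ∧ adjacent? (cell D i) (cell D j) })
                     (allPairs (size D))

covers : ∀ {n} → Fin n → Fin n × Fin n → Bool
covers k (i , j) = (toℕ i ≡ᵇ toℕ k) ∨ (toℕ j ≡ᵇ toℕ k)

isTiling : (D : QuadDisk) → Region D → Vec Bool (length (dominoes D)) → Bool
isTiling D R S =
  allFin (λ k → countIf (λ d → V.lookup S d ∧ covers k (L.lookup (dominoes D) d))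
                  ≡ᵇ (if V.lookup R k then 1 else 0))

numTilings : (D : QuadDisk) → Region D → ℕ
numTilings D R = length (filterᵇ (isTiling D R) (allSubsets (length (dominoes D))))

disjoint : (D : QuadDisk) → Region D → Region D → Bool
disjoint D p q = allFin (λ i → not (V.lookup p i ∧ V.lookup q i))

removeBoth : (D : QuadDisk) → Region D → Region D → Region D
removeBoth D p q = tabulate (λ i → not (V.lookup p i ∨ V.lookup q i))

A : (D : QuadDisk) → Region D → Region D → ℕ
A D p q = if disjoint D p q then numTilings D (removeBoth D p q) else 0

matPow : (D : QuadDisk) → ℕ → Region D → Region D → ℕ
matPow D zero p q = if does (≡-dec _≟ᴮ_ p q) then 1 else 0
matPow D (suc N) p q = sum (map (λ r → matPow D N p r * A D r q) (plugs D))

{-# OPTIONS --safe #-}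

-- Call plugs p and q adjacent when A p q > 0; a walk of length N between two plugs makes the
-- corresponding entry of A^N positive. If r, s and the squares covered by a packing M of dominoes
-- partition D, then M tiles D ∖ (r ∪ s), and since every domino covers one square of each colour
-- and D is balanced, s is a plug whenever r is. In particular every plug p is adjacent to its
-- complement, which gives detours of length 2. If p has a white square x, it also has a black one y;
-- along a path from x to y in D there is a simple segment a … b joining squares of p of opposite
-- colours with no other square in p. Pairing consecutive squares of the segment starting from its
-- second square tiles its interior I, and starting from a tiles all of it, so
-- p → D ∖ (p ∪ I) → p ∖ {a, b} are two steps that remove one white square. Hence each plug reaches
-- the empty plug in 2·(number of its white squares) ≤ 2|D| steps; p → ∅ → q and p → ∁p → ∅ → q are
-- walks of both parities of length at most 4|D| + 1, and detours extend them to every N ≥ 4|D|.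

module Submission where

open import Defs

import Data.Nat.Properties as ℕₚ
open import Algebra.Properties.CommutativeMonoid.Sum ℕₚ.+-0-commutativeMonoid
  using (∑-distrib-+; sum-cong-≗) renaming (sum to ∑)
open import Data.Bool using (Bool; true; false; if_then_else_; _∧_; _∨_; not; T)
open import Data.Bool.ListAction using (any)
open import Data.Bool.Properties
  using ( ∧-comm; ∨-comm; ∨-assoc; ∧-zeroʳ; ∨-zeroʳ; ∧-identityʳ; ∨-identityʳ; ∧-distribʳ-∨; ∧-distribˡ-∨
        ; not-involutive; not-injective; not-¬; ¬-not; T-∧; T-≡ )
  renaming (_≟_ to _≟ᴮ_)
open import Data.Empty using (⊥; ⊥-elim)
open import Data.Fin using (Fin; zero; suc; toℕ) renaming (_<?_ to _<ᶠ?_)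
open import Data.Fin.Properties as Finₚ using (toℕ-injective)
open import Data.Fin.Subset using (∁; Empty) renaming (⊥ to ∅)
open import Data.Fin.Subset.Properties using (Empty-unique)
open import Data.Integer as ℤ using (ℤ; -[1+_]; ∣_∣)
import Data.Integer.Properties as ℤₚ
open import Data.Integer.Tactic.RingSolver using (solve-∀)
open import Data.List as L using (List; []; _∷_; length)
open import Data.List.Membership.Propositional using (_∈_; lose)
open import Data.List.Membership.Propositional.Properties
  using (∈-lookup; ∈-++⁺ˡ; ∈-++⁺ʳ; ∈-map⁺; ∈-filter⁺; ∈-filter⁻; ∈-concatMap⁺; ∈-allFin)
open import Data.List.Relation.Unary.All as All using ()
open import Data.List.Relation.Unary.AllPairs using (_∷_)
open import Data.List.Relation.Unary.Any as Any using (here; there)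
open import Data.List.Relation.Unary.Any.Properties using (lookup-index)
open import Data.List.Relation.Unary.Unique.Propositional using (Unique)
open import Data.Nat as ℕ using (ℕ; zero; suc; _+_; _*_; _≤_; _<_; z≤n; s≤s; _≡ᵇ_; _%_)
open import Data.Nat.ListAction using (sum)
import Data.Nat.Tactic.RingSolver as NatSolver
open import Data.Product using (Σ; ∃-syntax; _×_; _,_; proj₁; proj₂)
open import Data.Sum using (_⊎_; inj₁; inj₂)
open import Data.Unit using (⊤)
open import Data.Vec as V using (Vec)
open import Data.Vec.Properties using (lookup∘tabulate; lookup-map; tabulate-cong; ≡-dec; count≤n; []=⇒lookup)
open import Function using (_∘_)
open import Function.Bundles using (Equivalence)
open import Relation.Binary.Definitions using (tri<; tri≈; tri>)
open import Relation.Binary.PropositionalEquality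
  using (_≡_; _≗_; refl; sym; trans; cong; cong₂; subst; module ≡-Reasoning)
open import Relation.Nullary using (¬_; does; yes; no)
open import Relation.Nullary.Decidable using (T?; dec-true)

∨-trueˡ : ∀ {x} y → x ≡ true → x ∨ y ≡ true
∨-trueˡ _ refl = refl

∨-trueʳ : ∀ x {y} → y ≡ true → x ∨ y ≡ true
∨-trueʳ x refl = ∨-zeroʳ x

∨-falseʳ : ∀ x {y} → x ∨ y ≡ false → y ≡ false
∨-falseʳ false y≡false = y≡false

∧≡true⇒ : ∀ x {y} → x ∧ y ≡ true → x ≡ true × y ≡ true
∧≡true⇒ true y≡true = refl , y≡true

+-cancel-sides : ∀ {a b a′ b′} m → a + b + m ≡ a′ + b′ + m → a ≡ a′ → b ≡ b′
+-cancel-sides {a} {b} {_} {b′} m eq refl = ℕₚ.+-cancelˡ-≡ a b b′ (ℕₚ.+-cancelʳ-≡ m (a + b) (a + b′) eq)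

parity : ∀ N → ∃[ h ] (N ≡ 2 * h ⊎ N ≡ suc (2 * h))
parity zero = 0 , inj₁ refl
parity (suc N) with parity N
... | h , inj₁ refl = h , inj₂ refl
... | h , inj₂ refl = suc h , inj₁ (sym (ℕₚ.*-suc 2 h))

half-bound : ∀ {a b n N h} → a ≤ n → b ≤ n → 4 * n ≤ N → N ≤ suc (2 * h) → a + b ≤ h
half-bound {a} {b} {n} {N} {h} a≤n b≤n 4n≤N N≤1+2h = ℕₚ.≤-pred (ℕₚ.*-cancelˡ-< 2 (a + b) (suc h) (begin-strict
  2 * (a + b)  ≤⟨ ℕₚ.*-monoʳ-≤ 2 (ℕₚ.+-mono-≤ a≤n b≤n) ⟩
  2 * (n + n)  ≡⟨ double-double n ⟩
  4 * n        ≤⟨ 4n≤N ⟩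
  N            ≤⟨ N≤1+2h ⟩
  suc (2 * h)  <⟨ ℕₚ.n<1+n _ ⟩
  2 + 2 * h    ≡⟨ ℕₚ.*-suc 2 h ⟨
  2 * suc h    ∎))
  where
  open ℕₚ.≤-Reasoning
  double-double : ∀ n → 2 * (n + n) ≡ 4 * n
  double-double = NatSolver.solve-∀

∈⇒≤sum : ∀ {m ms} → m ∈ ms → m ≤ sum ms
∈⇒≤sum (here refl)            = ℕₚ.m≤m+n _ _
∈⇒≤sum {ms = m′ ∷ _} (there m∈) = ℕₚ.≤-trans (∈⇒≤sum m∈) (ℕₚ.m≤n+m _ m′)

∈⇒0<length : ∀ {A : Set} {x : A} {xs} → x ∈ xs → 0 < length xs
∈⇒0<length (here _)  = s≤s z≤n
∈⇒0<length (there _) = s≤s z≤n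

lookup-injective : ∀ {A : Set} {xs : List A} → Unique xs → ∀ i j → L.lookup xs i ≡ L.lookup xs j → i ≡ j
lookup-injective (_   ∷ _) zero    zero    _  = refl
lookup-injective (x∉ ∷ _) zero    (suc j) eq = ⊥-elim (All.lookup x∉ (∈-lookup j) eq)
lookup-injective (x∉ ∷ _) (suc i) zero    eq = ⊥-elim (All.lookup x∉ (∈-lookup i) (sym eq))
lookup-injective (_   ∷ u) (suc i) (suc j) eq = cong suc (lookup-injective u i j eq)

∈-allSubsets : ∀ {m} (v : Vec Bool m) → v ∈ allSubsets m
∈-allSubsets V.[]               = here refl
∈-allSubsets (true  V.∷ v)      = ∈-++⁺ˡ (∈-map⁺ (true V.∷_) (∈-allSubsets v))
∈-allSubsets {suc m} (false V.∷ v) = ∈-++⁺ʳ (L.map (true V.∷_) (allSubsets m)) (∈-map⁺ (false V.∷_) (∈-allSubsets v))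

∈-allPairs : ∀ {n} (i j : Fin n) → (i , j) ∈ allPairs n
∈-allPairs i j = ∈-concatMap⁺ _ (lose (∈-allFin i) (∈-map⁺ (i ,_) (∈-allFin j)))

T-allFin : ∀ {n} {f : Fin n → Bool} → (∀ k → T (f k)) → T (allFin f)
T-allFin {zero}          _   = _
T-allFin {suc n} {f} all with f zero | all zero
... | true | _ = T-allFin (all ∘ suc)

Reach-start : ∀ {P : Cell → Set} {c e} → Reach P c e → P c
Reach-start (here c∈)     = c∈
Reach-start (step c∈ _ _) = c∈

-- Counting squares

⟦_⟧ : Bool → ℕ
⟦ b ⟧ = if b then 1 else 0

⟦∨⟧ : ∀ x y → x ∧ y ≡ false → ⟦ x ∨ y ⟧ ≡ ⟦ x ⟧ + ⟦ y ⟧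
⟦∨⟧ true  false _ = refl
⟦∨⟧ false _     _ = refl

⟦not⟧+⟦⟧ : ∀ x → ⟦ not x ⟧ + ⟦ x ⟧ ≡ 1
⟦not⟧+⟦⟧ true  = refl
⟦not⟧+⟦⟧ false = refl

count : ∀ {n} → (Fin n → Bool) → ℕ
count f = ∑ (⟦_⟧ ∘ f)

count-cong : ∀ {n} {f g : Fin n → Bool} → f ≗ g → count f ≡ count g
count-cong f≗g = sum-cong-≗ (cong ⟦_⟧ ∘ f≗g)

count-false : ∀ {n} → count {n} (λ _ → false) ≡ 0
count-false {zero}  = refl
count-false {suc n} = count-false {n}

count-∨ : ∀ {n} {f g : Fin n → Bool} → (∀ i → f i ∧ g i ≡ false) →
          count (λ i → f i ∨ g i) ≡ count f + count g
count-∨ {f = f} {g} f∩g≡∅ = trans (sum-cong-≗ (λ i → ⟦∨⟧ (f i) (g i) (f∩g≡∅ i))) (∑-distrib-+ (⟦_⟧ ∘ f) (⟦_⟧ ∘ g))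

count-∧-∨ : ∀ {n} {f g : Fin n → Bool} (c : Fin n → Bool) → (∀ i → f i ∧ g i ≡ false) →
            count (λ i → c i ∧ (f i ∨ g i)) ≡ count (λ i → c i ∧ f i) + count (λ i → c i ∧ g i)
count-∧-∨ {f = f} {g} c f∩g≡∅ =
  trans (count-cong (λ i → ∧-distribˡ-∨ (c i) (f i) (g i))) (count-∨ (λ i → restrict (c i) (f∩g≡∅ i)))
  where
  restrict : ∀ x {y z} → y ∧ z ≡ false → (x ∧ y) ∧ (x ∧ z) ≡ false
  restrict true  y∧z≡false = y∧z≡false
  restrict false _         = refl

count-∖-∩ : ∀ {n} (c f g : Fin n → Bool) →
            count (λ i → c i ∧ f i) ≡ count (λ i → c i ∧ (f i ∧ not (g i))) + count (λ i → c i ∧ (f i ∧ g i))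
count-∖-∩ c f g = trans (count-cong (λ i → cong (c i ∧_) (split (f i) (g i)))) (count-∧-∨ c (λ i → disjoint′ (f i) (g i)))
  where
  split : ∀ x y → x ≡ (x ∧ not y) ∨ (x ∧ y)
  split true  true  = refl
  split true  false = refl
  split false _     = refl
  disjoint′ : ∀ x y → (x ∧ not y) ∧ (x ∧ y) ≡ false
  disjoint′ true  true  = refl
  disjoint′ true  false = refl
  disjoint′ false _     = refl

count≡0⇒false : ∀ {n} (f : Fin n → Bool) → count f ≡ 0 → ∀ i → f i ≡ false
count≡0⇒false {suc n} f eq i with f zero in f0
count≡0⇒false {suc n} f eq zero    | false = f0
count≡0⇒false {suc n} f eq (suc i) | false = count≡0⇒false (f ∘ suc) eq i

count≡suc⇒∃ : ∀ {n m} (f : Fin n → Bool) → count f ≡ suc m → ∃[ i ] f i ≡ true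
count≡suc⇒∃ {suc n} f eq with f zero in f0
... | true  = zero , f0
... | false = let i , fi = count≡suc⇒∃ (f ∘ suc) eq in suc i , fi

countᵇ-tabulate : ∀ {n} {A : Set} (f : A → Bool) (g : Fin n → A) → V.countᵇ f (V.tabulate g) ≡ count (f ∘ g)
countᵇ-tabulate {zero}  f g = refl
countᵇ-tabulate {suc n} f g with f (g zero)
... | true  = cong suc (countᵇ-tabulate f (g ∘ suc))
... | false = countᵇ-tabulate f (g ∘ suc)

countIf≡count : ∀ {n} (f : Fin n → Bool) → countIf f ≡ count f
countIf≡count f = countᵇ-tabulate f (λ i → i)

-- The equality test `covers` is written with, so that `covers k (i , j)` unfolds to `(i == k) ∨ (j == k)`.
_==_ : ∀ {n} → Fin n → Fin n → Bool
i == j = toℕ i ≡ᵇ toℕ j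

==-refl : ∀ {n} (i : Fin n) → i == i ≡ true
==-refl zero    = refl
==-refl (suc i) = ==-refl i

==⇒≡ : ∀ {n} (i j : Fin n) → i == j ≡ true → i ≡ j
==⇒≡ i j eq = toℕ-injective (ℕₚ.≡ᵇ⇒≡ (toℕ i) (toℕ j) (subst T (sym eq) _))

==-false : ∀ {n} (f : Fin n → Bool) {i j} → f i ≡ false → f j ≡ true → i == j ≡ false
==-false f {i} {j} i∉f j∈f with i == j in i≡j
... | false = refl
... | true with refl ← ==⇒≡ i j i≡j with () ← trans (sym i∉f) j∈f

count-single : ∀ {n} (a : Fin n) (f : Fin n → Bool) → count (λ k → (a == k) ∧ f k) ≡ ⟦ f a ⟧
count-single {suc n} zero    f = trans (cong (⟦ f zero ⟧ +_) (count-false {n})) (ℕₚ.+-identityʳ _)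
count-single {suc n} (suc a) f = count-single a (f ∘ suc)

count-pair : ∀ {n} {a b : Fin n} (c : Fin n → Bool) → c a ≡ not (c b) →
             count (λ k → c k ∧ ((a == k) ∨ (b == k))) ≡ 1
count-pair {a = a} {b} c ca≡¬cb = begin
  count (λ k → c k ∧ ((a == k) ∨ (b == k)))
    ≡⟨ count-cong (λ k → trans (∧-comm (c k) _) (∧-distribʳ-∨ (c k) (a == k) (b == k))) ⟩
  count (λ k → ((a == k) ∧ c k) ∨ ((b == k) ∧ c k))
    ≡⟨ count-∨ separate ⟩
  count (λ k → (a == k) ∧ c k) + count (λ k → (b == k) ∧ c k)
    ≡⟨ cong₂ _+_ (count-single a c) (count-single b c) ⟩
  ⟦ c a ⟧ + ⟦ c b ⟧
    ≡⟨ cong (λ x → ⟦ x ⟧ + ⟦ c b ⟧) ca≡¬cb ⟩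
  ⟦ not (c b) ⟧ + ⟦ c b ⟧
    ≡⟨ ⟦not⟧+⟦⟧ (c b) ⟩
  1 ∎
  where
  open ≡-Reasoning
  separate : ∀ k → ((a == k) ∧ c k) ∧ ((b == k) ∧ c k) ≡ false
  separate k with a == k in ak | b == k in bk | c k in ck
  ... | false | _     | _     = refl
  ... | true  | false | false = refl
  ... | true  | false | true  = refl
  ... | true  | true  | false = refl
  ... | true  | true  | true  with refl ← ==⇒≡ a k ak with refl ← ==⇒≡ b k bk = ⊥-elim (not-¬ refl ca≡¬cb)

record Partition {n} (f g h : Fin n → Bool) : Set where
  constructor partition
  field one-at : ∀ k → ⟦ f k ⟧ + ⟦ g k ⟧ + ⟦ h k ⟧ ≡ 1

open Partition

exactly-one : ∀ x y z → ⟦ x ⟧ + ⟦ y ⟧ + ⟦ z ⟧ ≡ 1 → x ∧ y ≡ false × not (x ∨ y) ≡ z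
exactly-one true  false false _ = refl , refl
exactly-one false true  false _ = refl , refl
exactly-one false false true  _ = refl , refl
exactly-one true  true  _     ()
exactly-one true  false true  ()
exactly-one false true  true  ()
exactly-one false false false ()

Partition⇒disjoint : ∀ {n} {f g h : Fin n → Bool} → Partition f g h → ∀ k → f k ∧ g k ≡ false
Partition⇒disjoint {f = f} {g} {h} part k = proj₁ (exactly-one (f k) (g k) (h k) (one-at part k))

Partition⇒complement : ∀ {n} {f g h : Fin n → Bool} → Partition f g h → ∀ k → not (f k ∨ g k) ≡ h k
Partition⇒complement {f = f} {g} {h} part k = proj₂ (exactly-one (f k) (g k) (h k) (one-at part k))

count-partition : ∀ {n} {f g h : Fin n → Bool} → Partition f g h → (c : Fin n → Bool) →
                  count c ≡ count (λ k → c k ∧ f k) + count (λ k → c k ∧ g k) + count (λ k → c k ∧ h k)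
count-partition {f = f} {g} {h} part c = begin
  count c
    ≡⟨ sum-cong-≗ split ⟩
  ∑ (λ k → ⟦ c k ∧ f k ⟧ + ⟦ c k ∧ g k ⟧ + ⟦ c k ∧ h k ⟧)
    ≡⟨ ∑-distrib-+ (λ k → ⟦ c k ∧ f k ⟧ + ⟦ c k ∧ g k ⟧) (λ k → ⟦ c k ∧ h k ⟧) ⟩
  ∑ (λ k → ⟦ c k ∧ f k ⟧ + ⟦ c k ∧ g k ⟧) + count (λ k → c k ∧ h k)
    ≡⟨ cong (_+ count (λ k → c k ∧ h k)) (∑-distrib-+ (λ k → ⟦ c k ∧ f k ⟧) (λ k → ⟦ c k ∧ g k ⟧)) ⟩
  count (λ k → c k ∧ f k) + count (λ k → c k ∧ g k) + count (λ k → c k ∧ h k) ∎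
  where
  open ≡-Reasoning
  split : ∀ k → ⟦ c k ⟧ ≡ ⟦ c k ∧ f k ⟧ + ⟦ c k ∧ g k ⟧ + ⟦ c k ∧ h k ⟧
  split k with c k
  ... | true  = sym (one-at part k)
  ... | false = refl

-- Colours of adjacent squares

isEven : ℕ → Bool
isEven m = m % 2 ≡ᵇ 0

isEven-suc : ∀ m → isEven (suc m) ≡ not (isEven m)
isEven-suc zero    = refl
isEven-suc (suc m) = sym (trans (cong not (isEven-suc m)) (not-involutive _))

isEven-∣1+i∣ : ∀ i → isEven ∣ ℤ.+ 1 ℤ.+ i ∣ ≡ not (isEven ∣ i ∣)
isEven-∣1+i∣ (ℤ.+ m)          = isEven-suc m
isEven-∣1+i∣ -[1+ zero ]      = refl
isEven-∣1+i∣ -[1+ suc m ]     = isEven-suc m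

isEven-∣-1+i∣ : ∀ i → isEven ∣ -[1+ 0 ] ℤ.+ i ∣ ≡ not (isEven ∣ i ∣)
isEven-∣-1+i∣ (ℤ.+ zero)      = refl
isEven-∣-1+i∣ (ℤ.+ suc m)     = trans (sym (not-involutive _)) (cong not (sym (isEven-suc m)))
isEven-∣-1+i∣ -[1+ m ]        = isEven-suc (suc m)

isEven-∣u+i∣ : ∀ u i → ∣ u ∣ ≡ 1 → isEven ∣ u ℤ.+ i ∣ ≡ not (isEven ∣ i ∣)
isEven-∣u+i∣ (ℤ.+ 1)     i _ = isEven-∣1+i∣ i
isEven-∣u+i∣ -[1+ zero ] i _ = isEven-∣-1+i∣ i
isEven-∣u+i∣ (ℤ.+ zero)          i ()
isEven-∣u+i∣ (ℤ.+ suc (suc _))   i ()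
isEven-∣u+i∣ -[1+ suc _ ]        i ()

∣u+v∣≡1 : ∀ u v → ∣ u ∣ + ∣ v ∣ ≡ 1 → ∣ u ℤ.+ v ∣ ≡ 1
∣u+v∣≡1 (ℤ.+ zero)        v eq = trans (cong ∣_∣ (ℤₚ.+-identityˡ v)) eq
∣u+v∣≡1 (ℤ.+ 1)           v eq with refl ← ℤₚ.∣i∣≡0⇒i≡0 {v} (ℕₚ.suc-injective eq) = refl
∣u+v∣≡1 -[1+ zero ]       v eq with refl ← ℤₚ.∣i∣≡0⇒i≡0 {v} (ℕₚ.suc-injective eq) = refl
∣u+v∣≡1 (ℤ.+ suc (suc _)) v ()
∣u+v∣≡1 -[1+ suc _ ]      v ()

adjacent-colours : ∀ x y → Adjacent x y → colour x ≡ not (colour y)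
adjacent-colours (a , b) (c , d) adj = begin
  isEven ∣ a ℤ.+ b ∣                  ≡⟨ cong (isEven ∘ ∣_∣) (regroup a b c d) ⟩
  isEven ∣ Δ ℤ.+ (c ℤ.+ d) ∣          ≡⟨ isEven-∣u+i∣ Δ (c ℤ.+ d) (∣u+v∣≡1 (a ℤ.- c) (b ℤ.- d) adj) ⟩
  not (isEven ∣ c ℤ.+ d ∣)            ∎
  where
  open ≡-Reasoning
  Δ : ℤ
  Δ = a ℤ.- c ℤ.+ (b ℤ.- d)
  regroup : ∀ a b c d → a ℤ.+ b ≡ a ℤ.- c ℤ.+ (b ℤ.- d) ℤ.+ (c ℤ.+ d)
  regroup = solve-∀

adjacent-sym : ∀ x y → Adjacent x y → Adjacent y x
adjacent-sym (a , b) (c , d) adj = trans (cong₂ _+_ (ℤₚ.∣i-j∣≡∣j-i∣ c a) (ℤₚ.∣i-j∣≡∣j-i∣ d b)) adj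

adjacent-irrefl : ∀ x → ¬ Adjacent x x
adjacent-irrefl (a , b) adj
  with () ← trans (sym adj) (cong₂ _+_ (cong ∣_∣ (ℤₚ.+-inverseʳ a)) (cong ∣_∣ (ℤₚ.+-inverseʳ b)))

module _ (D : QuadDisk) where

  Square : Set
  Square = Fin (size D)

  Adj : Square → Square → Set
  Adj i j = Adjacent (cell D i) (cell D j)

  white black : Square → Bool
  white i = colour (cell D i)
  black i = not (white i)

  Alternating : (Square → Bool) → Set
  Alternating c = ∀ {i j} → Adj i j → c i ≡ not (c j)

  white-alternating : Alternating white
  white-alternating {i} {j} = adjacent-colours (cell D i) (cell D j)

  black-alternating : Alternating black
  black-alternating = cong not ∘ white-alternating

  #[_]_ : (Square → Bool) → Region D → ℕ
  #[ c ] r = count (λ i → c i ∧ V.lookup r i)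

  numPos≡#white : ∀ r → numPos D r ≡ #[ white ] r
  numPos≡#white r = trans (countIf≡count (λ i → V.lookup r i ∧ white i)) (count-cong λ i → ∧-comm (V.lookup r i) (white i))

  numNeg≡#black : ∀ r → numNeg D r ≡ #[ black ] r
  numNeg≡#black r = trans (countIf≡count (λ i → V.lookup r i ∧ black i)) (count-cong λ i → ∧-comm (V.lookup r i) (black i))

  IsPlug⇒#white≡#black : ∀ {r} → IsPlug D r → #[ white ] r ≡ #[ black ] r
  IsPlug⇒#white≡#black {r} r-plug = trans (sym (numPos≡#white r)) (trans r-plug (numNeg≡#black r))

  #white≤size : ∀ r → #[ white ] r ≤ size D
  #white≤size r = subst (_≤ size D) (numPos≡#white r) (count≤n (T? ∘ λ i → V.lookup r i ∧ white i) (V.tabulate (λ i → i)))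

  #-full : ∀ c → #[ c ] (full D) ≡ count c
  #-full c = count-cong λ i → trans (cong (c i ∧_) (lookup∘tabulate _ i)) (∧-identityʳ (c i))


  -- Dominoes, packings and tilings

  Domino : Set
  Domino = Fin (length (dominoes D))

  domino : Domino → Square × Square
  domino = L.lookup (dominoes D)

  ∈-dominoes⁻ : ∀ {i j} → (i , j) ∈ dominoes D → Adj i j
  ∈-dominoes⁻ {i} {j} i,j∈ = ℕₚ.≡ᵇ⇒≡ _ 1 (proj₂ (Equivalence.to T-∧ accepted))
    where
    accepted : T (does (i <ᶠ? j) ∧ adjacent? (cell D i) (cell D j))
    accepted = proj₂ (∈-filter⁻ (T? ∘ _) {xs = allPairs (size D)} i,j∈)

  domino-adjacent : ∀ d → Adj (proj₁ (domino d)) (proj₂ (domino d))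
  domino-adjacent d = ∈-dominoes⁻ (∈-lookup {xs = dominoes D} d)

  ∈-dominoes⁺ : ∀ {i j} → toℕ i < toℕ j → Adj i j → (i , j) ∈ dominoes D
  ∈-dominoes⁺ {i} {j} i<j adj = ∈-filter⁺ (T? ∘ _) (∈-allPairs i j) accepted
    where
    accepted : T (does (i <ᶠ? j) ∧ adjacent? (cell D i) (cell D j))
    accepted rewrite dec-true (i <ᶠ? j) i<j = ℕₚ.≡⇒≡ᵇ _ 1 adj

  dominoOn : ∀ {a b} → Adj a b → Σ Domino λ d → ∀ k → covers k (domino d) ≡ (a == k) ∨ (b == k)
  dominoOn {a} {b} adj with Finₚ.<-cmp a b
  ... | tri< a<b _ _ = Any.index a,b∈ , λ k → cong (covers k) (sym (lookup-index a,b∈))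
    where
    a,b∈ : (a , b) ∈ dominoes D
    a,b∈ = ∈-dominoes⁺ a<b adj
  ... | tri≈ _ refl _ = ⊥-elim (adjacent-irrefl (cell D a) adj)
  ... | tri> _ _ b<a = Any.index b,a∈ , λ k → trans (cong (covers k) (sym (lookup-index b,a∈))) (∨-comm (b == k) (a == k))
    where
    b,a∈ : (b , a) ∈ dominoes D
    b,a∈ = ∈-dominoes⁺ b<a (adjacent-sym (cell D a) (cell D b) adj)

  covered : List Domino → Square → Bool
  covered M k = any (λ d → covers k (domino d)) M

  data Packing : List Domino → Set where
    []  : Packing []
    _∷_ : ∀ {d M} → (∀ k → covers k (domino d) ∧ covered M k ≡ false) → Packing M → Packing (d ∷ M)

  count-covered : ∀ {M} → Packing M → ∀ {c} → Alternating c → count (λ k → c k ∧ covered M k) ≡ length M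
  count-covered [] {c} _ = trans (count-cong (λ k → ∧-zeroʳ (c k))) (count-false {size D})
  count-covered (_∷_ {d} {M} separate P) {c} alt = begin
    count (λ k → c k ∧ (covers k (domino d) ∨ covered M k))
      ≡⟨ count-∧-∨ {f = λ k → covers k (domino d)} {g = covered M} c separate ⟩
    count (λ k → c k ∧ covers k (domino d)) + count (λ k → c k ∧ covered M k)
      ≡⟨ cong₂ _+_ (count-pair {a = proj₁ (domino d)} {proj₂ (domino d)} c (alt (domino-adjacent d))) (count-covered P alt) ⟩
    suc (length M) ∎
    where open ≡-Reasoning

  listed : List Domino → Domino → Bool
  listed M d = any (_== d) M

  listed⇒covered : ∀ M d k → listed M d ≡ true → covers k (domino d) ≡ true → covered M k ≡ true
  listed⇒covered (e ∷ M) d k d∈M k∈d with e == d in e≡d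
  ... | true  with refl ← ==⇒≡ e d e≡d rewrite k∈d = refl
  ... | false rewrite listed⇒covered M d k d∈M k∈d = ∨-zeroʳ _

  count-listed : ∀ {M} → Packing M → ∀ k → count (λ d → listed M d ∧ covers k (domino d)) ≡ ⟦ covered M k ⟧
  count-listed [] k = count-false {length (dominoes D)}
  count-listed (_∷_ {d₀} {M} separate P) k = begin
    count (λ d → ((d₀ == d) ∨ listed M d) ∧ covers k (domino d))
      ≡⟨ count-cong (λ d → ∧-distribʳ-∨ (covers k (domino d)) (d₀ == d) (listed M d)) ⟩
    count (λ d → ((d₀ == d) ∧ covers k (domino d)) ∨ (listed M d ∧ covers k (domino d)))
      ≡⟨ count-∨ d₀-unlisted ⟩
    count (λ d → (d₀ == d) ∧ covers k (domino d)) + count (λ d → listed M d ∧ covers k (domino d))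
      ≡⟨ cong₂ _+_ (count-single d₀ (λ d → covers k (domino d))) (count-listed P k) ⟩
    ⟦ covers k (domino d₀) ⟧ + ⟦ covered M k ⟧
      ≡⟨ sym (⟦∨⟧ (covers k (domino d₀)) (covered M k) (separate k)) ⟩
    ⟦ covers k (domino d₀) ∨ covered M k ⟧ ∎
    where
    open ≡-Reasoning
    d₀-unlisted : ∀ d → ((d₀ == d) ∧ covers k (domino d)) ∧ (listed M d ∧ covers k (domino d)) ≡ false
    d₀-unlisted d with d₀ == d in d₀≡d | covers k (domino d) in k∈d | listed M d in d∈M
    ... | false | _     | _     = refl
    ... | true  | false | _     = refl
    ... | true  | true  | false = refl
    ... | true  | true  | true  with refl ← ==⇒≡ d₀ d d₀≡d
      with () ← trans (sym (cong₂ _∧_ k∈d (listed⇒covered M d₀ k d∈M k∈d))) (separate k)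

  packing⇒numTilings>0 : ∀ {M} → Packing M → (R : Region D) → (∀ k → V.lookup R k ≡ covered M k) → 0 < numTilings D R
  packing⇒numTilings>0 {M} P R R≗M = ∈⇒0<length (∈-filter⁺ (T? ∘ isTiling D R) (∈-allSubsets S) S-tiles)
    where
    S : Vec Bool (length (dominoes D))
    S = V.tabulate (listed M)
    S-tiles : T (isTiling D R S)
    S-tiles = T-allFin λ k → ℕₚ.≡⇒≡ᵇ _ _ (begin
      countIf (λ d → V.lookup S d ∧ covers k (domino d))
        ≡⟨ countIf≡count (λ d → V.lookup S d ∧ covers k (domino d)) ⟩
      count (λ d → V.lookup S d ∧ covers k (domino d))
        ≡⟨ count-cong (λ d → cong (_∧ covers k (domino d)) (lookup∘tabulate (listed M) d)) ⟩
      count (λ d → listed M d ∧ covers k (domino d))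
        ≡⟨ count-listed P k ⟩
      ⟦ covered M k ⟧
        ≡⟨ cong ⟦_⟧ (sym (R≗M k)) ⟩
      ⟦ V.lookup R k ⟧ ∎)
      where open ≡-Reasoning

  packing⇒A>0 : ∀ {M r s} → Packing M → Partition (V.lookup r) (V.lookup s) (covered M) → 0 < A D r s
  packing⇒A>0 {M} {r} {s} P part =
    subst (λ b → 0 < (if b then numTilings D (removeBoth D r s) else 0)) (sym r∩s≡∅)
      (packing⇒numTilings>0 P (removeBoth D r s) λ k →
        trans (lookup∘tabulate (λ i → not (V.lookup r i ∨ V.lookup s i)) k) (Partition⇒complement part k))
    where
    r∩s≡∅ : disjoint D r s ≡ true
    r∩s≡∅ = Equivalence.to T-≡ (T-allFin λ i → subst (T ∘ not) (sym (Partition⇒disjoint part i)) _)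

  A-sym : ∀ r s → A D r s ≡ A D s r
  A-sym r s = cong₂ (λ b R → if b then numTilings D R else 0)
    (cong (V.foldr _ _∧_ true) (tabulate-cong λ i → cong not (∧-comm (V.lookup r i) (V.lookup s i))))
    (tabulate-cong λ i → cong not (∨-comm (V.lookup r i) (V.lookup s i)))

  -- Walks between plugs

  record Edge (r s : Region D) : Set where
    field
      source-plug : IsPlug D r
      target-plug : IsPlug D s
      A>0         : 0 < A D r s

  open Edge

  Edge-sym : ∀ {r s} → Edge r s → Edge s r
  Edge-sym {r} {s} e = record
    { source-plug = target-plug e ; target-plug = source-plug e ; A>0 = subst (0 <_) (A-sym r s) (A>0 e) }

  infixl 5 _▷_
  infixr 5 _◁_

  -- Walks grow at their end, as matPow does.
  data Walk : ℕ → Region D → Region D → Set where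
    []  : ∀ {p} → Walk 0 p p
    _▷_ : ∀ {k p r q} → Walk k p r → Edge r q → Walk (suc k) p q

  _◁_ : ∀ {k p r q} → Edge p r → Walk k r q → Walk (suc k) p q
  e ◁ []       = [] ▷ e
  e ◁ (w ▷ e′) = (e ◁ w) ▷ e′

  reverse : ∀ {k p q} → Walk k p q → Walk k q p
  reverse []      = []
  reverse (w ▷ e) = Edge-sym e ◁ reverse w

  _++_ : ∀ {k l p r q} → Walk k p r → Walk l r q → Walk (l + k) p q
  w ++ []      = w
  w ++ (v ▷ e) = (w ++ v) ▷ e

  cast : ∀ {k l p q} → k ≡ l → Walk k p q → Walk l p q
  cast refl w = w

  Walk⇒matPow>0 : ∀ {N p q} → Walk N p q → 0 < matPow D N p q
  Walk⇒matPow>0 {p = p} [] rewrite dec-true (≡-dec _≟ᴮ_ p p) refl = s≤s z≤n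
  Walk⇒matPow>0 {suc N} {p} {q} (_▷_ {r = r} w e) = ℕₚ.≤-trans (ℕₚ.*-mono-≤ (Walk⇒matPow>0 w) (A>0 e))
    (∈⇒≤sum (∈-map⁺ (λ r → matPow D N p r * A D r q)
      (∈-filter⁺ (λ p → numPos D p ℕ.≟ numNeg D p) (∈-allSubsets r) (source-plug e))))

  -- Paths of squares

  white-two-steps : ∀ {a c e} → Adj a c → Adj c e → white e ≡ white a
  white-two-steps ac ce = sym (trans (white-alternating ac) (trans (cong not (white-alternating ce)) (not-involutive _)))

  data Path : Square → Square → Set where
    [_]    : ∀ x → Path x x
    _∷⟨_⟩_ : ∀ x {y z} → Adj x y → Path y z → Path x z

  squares : ∀ {x z} → Path x z → Square → Bool
  squares [ x ]          k = x == k
  squares (x ∷⟨ _ ⟩ w) k = (x == k) ∨ squares w k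

  Simple : ∀ {x z} → Path x z → Set
  Simple [ _ ]          = ⊤
  Simple (x ∷⟨ _ ⟩ w) = squares w x ≡ false × Simple w

  _⊆_ : (Square → Bool) → (Square → Bool) → Set
  f ⊆ g = ∀ k → f k ≡ true → g k ≡ true

  start∈squares : ∀ {x z} (w : Path x z) → squares w x ≡ true
  start∈squares [ x ]          = ==-refl x
  start∈squares (x ∷⟨ _ ⟩ w) = ∨-trueˡ (squares w x) (==-refl x)

  end∈squares : ∀ {x z} (w : Path x z) → squares w z ≡ true
  end∈squares [ z ]          = ==-refl z
  end∈squares {z = z} (x ∷⟨ _ ⟩ w) = ∨-trueʳ (x == z) (end∈squares w)

  suffix : ∀ {y z x} (w : Path y z) → squares w x ≡ true → Simple w → Σ (Path x z) λ s → Simple s × squares s ⊆ squares w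
  suffix {x = x} [ y ] x∈w _ with refl ← ==⇒≡ y x x∈w = [ y ] , _ , λ _ k∈ → k∈
  suffix {x = x} (y ∷⟨ h ⟩ w) x∈w (y∉w , w-simple) with y == x in y≡x
  ... | true with refl ← ==⇒≡ y x y≡x = y ∷⟨ h ⟩ w , (y∉w , w-simple) , λ _ k∈ → k∈
  ... | false = let s , s-simple , s⊆w = suffix w x∈w w-simple in s , s-simple , λ k k∈ → ∨-trueʳ (y == k) (s⊆w k k∈)

  erase-loops : ∀ {x z} (w : Path x z) → Σ (Path x z) λ s → Simple s × squares s ⊆ squares w
  erase-loops [ x ] = [ x ] , _ , λ _ k∈ → k∈
  erase-loops (x ∷⟨ h ⟩ w) with erase-loops w
  ... | s , s-simple , s⊆w with squares s x in x∈s
  ...   | true  = let s′ , s′-simple , s′⊆s = suffix s x∈s s-simple in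
                  s′ , s′-simple , λ k k∈ → ∨-trueʳ (x == k) (s⊆w k (s′⊆s k k∈))
  ...   | false = x ∷⟨ h ⟩ s , (x∈s , s-simple) , λ k → ∨-mono (x == k) (s⊆w k)
    where
    ∨-mono : ∀ b {c d} → (c ≡ true → d ≡ true) → b ∨ c ≡ true → b ∨ d ≡ true
    ∨-mono true  _ _ = refl
    ∨-mono false f   = f

  _▷⟨_⟩ : ∀ {a c d} → Path a c → Adj c d → Path a d
  [ a ]          ▷⟨ h ⟩ = a ∷⟨ h ⟩ [ _ ]
  (a ∷⟨ h′ ⟩ w) ▷⟨ h ⟩ = a ∷⟨ h′ ⟩ (w ▷⟨ h ⟩)

  ∈-▷ : ∀ {a c d} (w : Path a c) (h : Adj c d) k → squares (w ▷⟨ h ⟩) k ≡ true → squares w k ≡ true ⊎ d ≡ k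
  ∈-▷ [ a ] h k k∈ with a == k
  ... | true  = inj₁ refl
  ... | false = inj₂ (==⇒≡ _ k k∈)
  ∈-▷ (a ∷⟨ _ ⟩ w) h k k∈ with a == k
  ... | true  = inj₁ refl
  ... | false = ∈-▷ w h k k∈

  record Segment (p : Square → Bool) : Set where
    constructor mkSegment
    field
      start end : Square
      path      : Path start end
      simple    : Simple path
      start∈p   : p start ≡ true
      end∈p     : p end ≡ true
      colours   : white start ≡ not (white end)
      only-ends : ∀ k → squares path k ≡ true → p k ≡ true → k ≡ start ⊎ k ≡ end

  -- `pre` leads from a, the last square of p passed so far, to c and meets p only at a.
  segment-from : ∀ {a c y} (p : Square → Bool) → p a ≡ true → white a ≡ not (white y) →
                 (pre : Path a c) → (∀ k → squares pre k ≡ true → p k ≡ true → k ≡ a) →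
                 Path c y → p y ≡ true → Segment p
  segment-from p a∈p a≢y pre only-a [ c ] y∈p with refl ← only-a c (end∈squares pre) y∈p = ⊥-elim (not-¬ refl a≢y)
  segment-from {a} p a∈p a≢y pre only-a (_∷⟨_⟩_ c {d} h w) y∈p with p d in d∈p
  ... | false = segment-from p a∈p a≢y (pre ▷⟨ h ⟩) only-a′ w y∈p
    where
    only-a′ : ∀ k → squares (pre ▷⟨ h ⟩) k ≡ true → p k ≡ true → k ≡ a
    only-a′ k k∈ k∈p with ∈-▷ pre h k k∈
    ... | inj₁ k∈pre = only-a k k∈pre k∈p
    ... | inj₂ refl with () ← trans (sym d∈p) k∈p
  ... | true with white d ≟ᴮ white a
  ...   | yes same = segment-from p d∈p (trans same a≢y) [ d ] (λ k k∈ _ → sym (==⇒≡ d k k∈)) w y∈p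
  ...   | no differ with erase-loops (pre ▷⟨ h ⟩)
  ...     | s , s-simple , s⊆ =
    mkSegment a d s s-simple a∈p d∈p (¬-not (differ ∘ sym)) (λ k k∈ k∈p → ends k (s⊆ k k∈) k∈p)
    where
    ends : ∀ k → squares (pre ▷⟨ h ⟩) k ≡ true → p k ≡ true → k ≡ a ⊎ k ≡ d
    ends k k∈ k∈p with ∈-▷ pre h k k∈
    ... | inj₁ k∈pre = inj₁ (only-a k k∈pre k∈p)
    ... | inj₂ d≡k   = inj₂ (sym d≡k)

  segment : ∀ {x y} (p : Square → Bool) → p x ≡ true → p y ≡ true → white x ≡ not (white y) → Path x y → Segment p
  segment {x} p x∈p y∈p x≢y w = segment-from p x∈p x≢y [ x ] (λ k k∈ _ → sym (==⇒≡ x k k∈)) w y∈p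

  Reach⇒Path : ∀ {c e} → Reach (_∈ cells D) c e → ∀ {x y} → cell D x ≡ c → cell D y ≡ e → Path x y
  Reach⇒Path (here _) {x} {y} refl y≡c = subst (Path x) (lookup-injective (unique D) x y (sym y≡c)) [ x ]
  Reach⇒Path (step {d = d} _ adj r) {x} refl y≡e =
    x ∷⟨ subst (Adjacent (cell D x)) (lookup-index d∈) adj ⟩ Reach⇒Path r (sym (lookup-index d∈)) y≡e
    where
    d∈ : d ∈ cells D
    d∈ = Reach-start r

  path-between : (x y : Square) → Path x y
  path-between x y = Reach⇒Path (connected D (cell D x) (cell D y) (∈-lookup x) (∈-lookup y)) refl refl

  pairing : ∀ {a b} → Path a b → List Domino
  pairing [ _ ]                    = []
  pairing (_ ∷⟨ h ⟩ [ _ ])        = proj₁ (dominoOn h) ∷ []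
  pairing (_ ∷⟨ h ⟩ (_ ∷⟨ _ ⟩ w)) = proj₁ (dominoOn h) ∷ pairing w

  pairing-covers : ∀ {a b} (w : Path a b) k → covered (pairing w) k ∨ (b == k) ≡ squares w k
  pairing-covers [ a ] k = refl
  pairing-covers (a ∷⟨ h ⟩ [ b ]) k rewrite proj₂ (dominoOn h) k with a == k | b == k
  ... | true  | _     = refl
  ... | false | true  = refl
  ... | false | false = refl
  pairing-covers {b = b} (a ∷⟨ h ⟩ (c ∷⟨ _ ⟩ w)) k rewrite proj₂ (dominoOn h) k = begin
    (a∨c ∨ covered (pairing w) k) ∨ (b == k)  ≡⟨ ∨-assoc a∨c (covered (pairing w) k) (b == k) ⟩
    a∨c ∨ (covered (pairing w) k ∨ (b == k))  ≡⟨ cong (a∨c ∨_) (pairing-covers w k) ⟩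
    a∨c ∨ squares w k                          ≡⟨ ∨-assoc (a == k) (c == k) (squares w k) ⟩
    (a == k) ∨ ((c == k) ∨ squares w k)        ∎
    where
    open ≡-Reasoning
    a∨c = (a == k) ∨ (c == k)

  covered-pairing⊆squares : ∀ {a b} (w : Path a b) → covered (pairing w) ⊆ squares w
  covered-pairing⊆squares w k k∈ = trans (sym (pairing-covers w k)) (∨-trueˡ _ k∈)

  pairing-covers-end : ∀ {a b} (w : Path a b) → white a ≡ not (white b) → covered (pairing w) b ≡ true
  pairing-covers-end [ a ] a≢a = ⊥-elim (not-¬ refl a≢a)
  pairing-covers-end {b = b} (a ∷⟨ h ⟩ [ b ]) _ rewrite proj₂ (dominoOn h) b | ==-refl b | ∨-zeroʳ (a == b) = refl
  pairing-covers-end {b = b} (a ∷⟨ h ⟩ (c ∷⟨ h′ ⟩ w)) a≢b =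
    ∨-trueʳ (covers b (domino (proj₁ (dominoOn h)))) (pairing-covers-end w (trans (white-two-steps h h′) a≢b))

  pairing-covers-even : ∀ {a b} (w : Path a b) → white a ≡ not (white b) → ∀ k → covered (pairing w) k ≡ squares w k
  pairing-covers-even {b = b} w a≢b k with b == k in b≡k
  ... | true with refl ← ==⇒≡ b k b≡k = trans (pairing-covers-end w a≢b) (sym (end∈squares w))
  ... | false = trans (sym (∨-identityʳ _)) (trans (cong (covered (pairing w) k ∨_) (sym b≡k)) (pairing-covers w k))

  pairing-avoids-end : ∀ {a b} (w : Path a b) → white a ≡ white b → Simple w → covered (pairing w) b ≡ false
  pairing-avoids-end [ a ] _ _ = refl
  pairing-avoids-end (a ∷⟨ h ⟩ [ b ]) a≡b _ = ⊥-elim (not-¬ a≡b (white-alternating h))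
  pairing-avoids-end {b = b} (a ∷⟨ h ⟩ (c ∷⟨ h′ ⟩ w)) a≡b (a∉ , c∉ , w-simple)
    rewrite proj₂ (dominoOn h) b
          | ==-false (squares (c ∷⟨ h′ ⟩ w)) a∉ (end∈squares (c ∷⟨ h′ ⟩ w))
          | ==-false (squares w) c∉ (end∈squares w) = pairing-avoids-end w (trans (white-two-steps h h′) a≡b) w-simple

  pairing-packing : ∀ {a b} (w : Path a b) → Simple w → Packing (pairing w)
  pairing-packing [ _ ] _ = []
  pairing-packing (a ∷⟨ h ⟩ [ b ]) _ = (λ k → ∧-zeroʳ _) ∷ []
  pairing-packing (a ∷⟨ h ⟩ (c ∷⟨ h′ ⟩ w)) (a∉ , c∉ , w-simple) = separate ∷ pairing-packing w w-simple
    where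
    separate : ∀ k → covers k (domino (proj₁ (dominoOn h))) ∧ covered (pairing w) k ≡ false
    separate k with covered (pairing w) k in k∈
    ... | false = ∧-zeroʳ _
    ... | true rewrite proj₂ (dominoOn h) k
                     | ==-false (squares w) (∨-falseʳ (c == a) a∉) (covered-pairing⊆squares w k k∈)
                     | ==-false (squares w) c∉ (covered-pairing⊆squares w k k∈) = refl

  -- Descent to the empty plug

  module _ (balanced : Balanced D) where

    count-white≡count-black : count white ≡ count black
    count-white≡count-black = begin
      count white            ≡⟨ #-full white ⟨
      #[ white ] (full D)    ≡⟨ numPos≡#white (full D) ⟨
      numPos D (full D)      ≡⟨ balanced ⟩
      numNeg D (full D)      ≡⟨ numNeg≡#black (full D) ⟩
      #[ black ] (full D)    ≡⟨ #-full black ⟩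
      count black            ∎
      where open ≡-Reasoning

    transfer : ∀ {M r s} → Packing M → Partition (V.lookup r) (V.lookup s) (covered M) → IsPlug D r → Edge r s
    transfer {M} {r} {s} P part r-plug =
      record { source-plug = r-plug ; target-plug = s-plug ; A>0 = packing⇒A>0 {M} {r} {s} P part }
      where
      colour-split : ∀ {c} → Alternating c → count c ≡ #[ c ] r + #[ c ] s + length M
      colour-split {c} alt = trans (count-partition part c) (cong (#[ c ] r + #[ c ] s +_) (count-covered P alt))
      s-plug : IsPlug D s
      s-plug = begin
        numPos D s     ≡⟨ numPos≡#white s ⟩
        #[ white ] s   ≡⟨ +-cancel-sides (length M) both-colours (IsPlug⇒#white≡#black {r} r-plug) ⟩
        #[ black ] s   ≡⟨ numNeg≡#black s ⟨
        numNeg D s     ∎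
        where
        open ≡-Reasoning
        both-colours : #[ white ] r + #[ white ] s + length M ≡ #[ black ] r + #[ black ] s + length M
        both-colours = trans (sym (colour-split white-alternating)) (trans count-white≡count-black (colour-split black-alternating))

    complement-edge : ∀ {p} → IsPlug D p → Edge p (∁ p)
    complement-edge {p} = transfer [] (partition exactly-one-at)
      where
      exactly-one-at : ∀ k → ⟦ V.lookup p k ⟧ + ⟦ V.lookup (∁ p) k ⟧ + ⟦ covered [] k ⟧ ≡ 1
      exactly-one-at k rewrite lookup-map k not p with V.lookup p k
      ... | true  = refl
      ... | false = refl

    pad : ∀ j {k p q} → IsPlug D q → Walk k p q → Walk (2 * j + k) p q
    pad zero    _      w = w
    pad (suc j) {k} {q = q} q-plug w = cast (cong (_+ k) (sym (ℕₚ.*-suc 2 j))) (pad j q-plug w ▷ q→∁q ▷ Edge-sym q→∁q)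
      where
      q→∁q : Edge q (∁ q)
      q→∁q = complement-edge q-plug

    lengthen : ∀ e {s h p q} → s ≤ h → IsPlug D q → Walk (e + 2 * s) p q → Walk (e + 2 * h) p q
    lengthen e {s} s≤h q-plug w with j , refl ← ℕₚ.m≤n⇒∃[o]m+o≡n s≤h = cast (rearrange e s j) (pad j q-plug w)
      where
      rearrange : ∀ e s j → 2 * j + (e + 2 * s) ≡ e + 2 * (s + j)
      rearrange = NatSolver.solve-∀

    descend-along : ∀ {p} → IsPlug D p → Segment (V.lookup p) →
                    ∃[ p₁ ] ∃[ p₂ ] Edge p p₁ × Edge p₁ p₂ × #[ white ] p ≡ suc (#[ white ] p₂)
    descend-along _ (mkSegment _ _ [ _ ] _ _ _ a≢a _) = ⊥-elim (not-¬ refl a≢a)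
    descend-along {p} p-plug (mkSegment a b (_∷⟨_⟩_ a {c} h w) (a∉w , w-simple) a∈p b∈p a≢b only-ends) =
      s₁ , s₂ , e₁ , e₂ , measure
      where
      -- I is the interior of the segment S: the step p → s₁ leaves I to be tiled, the step s₁ → s₂ all of S.
      P I S : Square → Bool
      P = V.lookup p
      I = covered (pairing w)
      S = squares (a ∷⟨ h ⟩ w)
      s₁ s₂ : Region D
      s₁ = V.tabulate (λ k → not (P k ∨ I k))
      s₂ = V.tabulate (λ k → P k ∧ not (S k))

      b∉I : I b ≡ false
      b∉I = pairing-avoids-end w (not-injective (trans (sym (white-alternating h)) a≢b)) w-simple

      P∩I≡∅ : ∀ k → P k ∧ I k ≡ false
      P∩I≡∅ k with I k in k∈I | P k in k∈P
      ... | false | _     = ∧-zeroʳ _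
      ... | true  | false = refl
      ... | true  | true with only-ends k (∨-trueʳ (a == k) (covered-pairing⊆squares w k k∈I)) k∈P
      ...   | inj₁ refl with () ← trans (sym a∉w) (covered-pairing⊆squares w k k∈I)
      ...   | inj₂ refl with () ← trans (sym b∉I) k∈I

      S≡ : ∀ k → S k ≡ (a == k) ∨ (I k ∨ (b == k))
      S≡ k = cong ((a == k) ∨_) (sym (pairing-covers w k))

      outside : ∀ k → P k ≡ false → (a == k) ≡ false × (b == k) ≡ false
      outside k k∉P = ==-false (not ∘ P) (cong not a∈p) (cong not k∉P) , ==-false (not ∘ P) (cong not b∈p) (cong not k∉P)

      e₁ : Edge p s₁
      e₁ = transfer (pairing-packing w w-simple) (partition exactly-one-at) p-plug
        where
        layers : ∀ x i → x ∧ i ≡ false → ⟦ x ⟧ + ⟦ not (x ∨ i) ⟧ + ⟦ i ⟧ ≡ 1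
        layers true  false _ = refl
        layers false true  _ = refl
        layers false false _ = refl
        exactly-one-at : ∀ k → ⟦ P k ⟧ + ⟦ V.lookup s₁ k ⟧ + ⟦ I k ⟧ ≡ 1
        exactly-one-at k rewrite lookup∘tabulate (λ k → not (P k ∨ I k)) k = layers (P k) (I k) (P∩I≡∅ k)

      e₂ : Edge s₁ s₂
      e₂ = transfer (pairing-packing (a ∷⟨ h ⟩ w) (a∉w , w-simple)) (partition exactly-one-at) (target-plug e₁)
        where
        layers : ∀ x i α β → x ∧ i ≡ false → (x ≡ false → α ≡ false × β ≡ false) →
                 ⟦ not (x ∨ i) ⟧ + ⟦ x ∧ not (α ∨ (i ∨ β)) ⟧ + ⟦ α ∨ (i ∨ β) ⟧ ≡ 1
        layers true  false α β _ _ = ⟦not⟧+⟦⟧ (α ∨ β)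
        layers false i     α β _ ends-outside with ends-outside refl
        layers false true  _ _ _ _ | refl , refl = refl
        layers false false _ _ _ _ | refl , refl = refl
        exactly-one-at : ∀ k → ⟦ V.lookup s₁ k ⟧ + ⟦ V.lookup s₂ k ⟧ + ⟦ covered (pairing (a ∷⟨ h ⟩ w)) k ⟧ ≡ 1
        exactly-one-at k rewrite lookup∘tabulate (λ k → not (P k ∨ I k)) k
                               | lookup∘tabulate (λ k → P k ∧ not (S k)) k
                               | pairing-covers-even (a ∷⟨ h ⟩ w) a≢b k
                               | S≡ k = layers (P k) (I k) (a == k) (b == k) (P∩I≡∅ k) (outside k)

      P∩S≡ends : ∀ k → P k ∧ S k ≡ (a == k) ∨ (b == k)
      P∩S≡ends k rewrite S≡ k with P k in k∈P
      ... | true  rewrite trans (sym (cong (_∧ I k) k∈P)) (P∩I≡∅ k) = refl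
      ... | false rewrite proj₁ (outside k k∈P) | proj₂ (outside k k∈P) = refl

      measure : #[ white ] p ≡ suc (#[ white ] s₂)
      measure = begin
        #[ white ] p
          ≡⟨ count-∖-∩ white P S ⟩
        count (λ k → white k ∧ (P k ∧ not (S k))) + count (λ k → white k ∧ (P k ∧ S k))
          ≡⟨ cong₂ _+_ (count-cong λ k → cong (white k ∧_) (sym (lookup∘tabulate (λ k → P k ∧ not (S k)) k)))
                       (trans (count-cong λ k → cong (white k ∧_) (P∩S≡ends k)) (count-pair white a≢b)) ⟩
        #[ white ] s₂ + 1
          ≡⟨ ℕₚ.+-comm _ 1 ⟩
        suc (#[ white ] s₂) ∎
        where open ≡-Reasoning

    descend : ∀ {p m} → IsPlug D p → #[ white ] p ≡ suc m →
              ∃[ p₁ ] ∃[ p₂ ] Edge p p₁ × Edge p₁ p₂ × #[ white ] p ≡ suc (#[ white ] p₂)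
    descend {p} p-plug #white≡1+m
      with x , x∈ ← count≡suc⇒∃ _ #white≡1+m
         | y , y∈ ← count≡suc⇒∃ _ (trans (sym (IsPlug⇒#white≡#black {p} p-plug)) #white≡1+m)
      with x-white , x∈p ← ∧≡true⇒ (white x) x∈
         | y-black , y∈p ← ∧≡true⇒ (black y) y∈
      = descend-along p-plug (segment (V.lookup p) x∈p y∈p (trans x-white (sym y-black)) (path-between x y))

    walk-to-∅ : ∀ m {p} → IsPlug D p → #[ white ] p ≡ m → Walk (2 * m) p ∅
    walk-to-∅ zero {p} p-plug no-white = subst (Walk 0 p) (Empty-unique no-square) []
      where
      neither : ∀ x {y} → y ≡ true → x ∧ y ≡ false → not x ∧ y ≡ false → ⊥
      neither true  refl () _
      neither false refl _  ()
      no-black : #[ black ] p ≡ 0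
      no-black = trans (sym (IsPlug⇒#white≡#black {p} p-plug)) no-white
      no-square : Empty p
      no-square (i , i∈p) = neither (white i) ([]=⇒lookup i∈p) (count≡0⇒false _ no-white i) (count≡0⇒false _ no-black i)
    walk-to-∅ (suc m) p-plug #white≡1+m with descend p-plug #white≡1+m
    ... | _ , _ , e₁ , e₂ , shrinks = cast (sym (ℕₚ.*-suc 2 m))
      (e₁ ◁ e₂ ◁ walk-to-∅ m (target-plug e₂) (ℕₚ.suc-injective (trans (sym shrinks) #white≡1+m)))

    walk-via-∅ : ∀ {p q} → IsPlug D p → IsPlug D q → Walk (2 * (#[ white ] q + #[ white ] p)) p q
    walk-via-∅ {p} {q} p-plug q-plug = cast (sym (ℕₚ.*-distribˡ-+ 2 (#[ white ] q) (#[ white ] p)))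
      (walk-to-∅ _ p-plug refl ++ reverse (walk-to-∅ _ q-plug refl))

    walk-of-length : ∀ N {p q} → 4 * size D ≤ N → IsPlug D p → IsPlug D q → Walk N p q
    walk-of-length N {p} {q} 4n≤N p-plug q-plug with parity N
    ... | h , inj₁ refl = lengthen 0 {h = h} (half-bound (#white≤size q) (#white≤size p) 4n≤N (ℕₚ.n≤1+n _)) q-plug
      (walk-via-∅ p-plug q-plug)
    ... | h , inj₂ refl = lengthen 1 {h = h} (half-bound (#white≤size q) (#white≤size (∁ p)) 4n≤N ℕₚ.≤-refl) q-plug
      (p→∁p ◁ walk-via-∅ (target-plug p→∁p) q-plug)
      where
      p→∁p : Edge p (∁ p)
      p→∁p = complement-edge p-plug

lemma5p1 : (D : QuadDisk) → Balanced D → (N : ℕ) → 4 * size D ≤ N →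
             (p q : Region D) → IsPlug D p → IsPlug D q → 0 < matPow D N p q
lemma5p1 D balanced N 4n≤N p q p-plug q-plug = Walk⇒matPow>0 D (walk-of-length D balanced N 4n≤N p-plug q-plug)
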